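{- Let $F$ be a finite field and $n>1$. Then for any finite ring $R$, the unitary Cayley graph $\Gamma(R\times M_n(F))$ is not well-covered.
   Context: Rings are finite, associative, with nonzero identity. The unitary Cayley graph $\Gamma(S)$ of a ring $S$ has vertex set $S$, with distinct $x,y$ adjacent iff $x-y$ is a unit of $S$. A graph is well-covered if all its maximal independent sets have the same size. -}

module Defs where

open import Level using (Level; _⊔_)
open import Data.Nat using (ℕ)
open import Data.Fin using (Fin; zero; suc; _≟_)
open import Data.Product using (Σ; ∃; _×_; _,_)
open import Data.List using (List; []; _∷_; length)
open import Data.List.Relation.Unary.Any using (Any)
open import Relation.Nullary using (¬_; yes; no)
open import Relation.Binary.PropositionalEquality using (_≡_)
open import Algebra.Bundles using (Ring; CommutativeRing)
open import Algebra.Bundles.Raw using (RawRing)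
import Algebra.Construct.DirectProduct as DP

private variable c ℓ : Level

IsFiniteCarrier : {A : Set c} → (A → A → Set ℓ) → Set (c ⊔ ℓ)
IsFiniteCarrier {A = A} _≈_ =
  Σ ℕ λ k → Σ (Fin k → A) λ enum →
    (∀ x → ∃ λ i → enum i ≈ x) × (∀ i j → enum i ≈ enum j → i ≡ j)

record FiniteRing c ℓ : Set (Level.suc (c ⊔ ℓ)) where
  field
    ring    : Ring c ℓ
  open Ring ring
  field
    1≉0     : ¬ (1# ≈ 0#)
    finite  : IsFiniteCarrier _≈_

record FiniteField c ℓ : Set (Level.suc (c ⊔ ℓ)) where
  field
    commRing : CommutativeRing c ℓ
  open CommutativeRing commRing using (Carrier; _≈_; _+_; _*_; -_; 0#; 1#)
  field
    1≉0      : ¬ (1# ≈ 0#)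
    inverse  : ∀ x → ¬ (x ≈ 0#) → ∃ λ y → x * y ≈ 1#
    finite   : IsFiniteCarrier _≈_

module _ (F : FiniteField c ℓ) where
  open FiniteField F
  open CommutativeRing commRing using (Carrier; _≈_; _+_; _*_; -_; 0#; 1#)

  Matrix : ℕ → Set c
  Matrix n = Fin n → Fin n → Carrier

  sumF : (n : ℕ) → (Fin n → Carrier) → Carrier
  sumF ℕ.zero    f = 0#
  sumF (ℕ.suc n) f = f zero + sumF n (λ k → f (suc k))

  matRawRing : ℕ → RawRing c ℓ
  matRawRing n = record
    { Carrier = Matrix n
    ; _≈_ = λ A B → ∀ i j → A i j ≈ B i j
    ; _+_ = λ A B i j → A i j + B i j
    ; _*_ = λ A B i j → sumF n (λ k → A i k * B k j)
    ; -_  = λ A i j → - A i j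
    ; 0#  = λ i j → 0#
    ; 1#  = λ i j → δ i j
    }
    where
    δ : Fin n → Fin n → Carrier
    δ i j with i ≟ j
    ... | yes _ = 1#
    ... | no  _ = 0#

module _ (S : RawRing c ℓ) where
  open RawRing S

  IsUnit : Carrier → Set (c ⊔ ℓ)
  IsUnit u = ∃ λ v → (u * v ≈ 1#) × (v * u ≈ 1#)

  Adjacent : Carrier → Carrier → Set (c ⊔ ℓ)
  Adjacent x y = ¬ (x ≈ y) × IsUnit (x + - y)

  _∈S_ : Carrier → List Carrier → Set (c ⊔ ℓ)
  x ∈S xs = Any (λ y → x ≈ y) xs

  -- a finite vertex set represented by a duplicate-free list
  NoDup : List Carrier → Set (c ⊔ ℓ)
  NoDup [] = Level.Lift _ Data.Unit.⊤
    where import Data.Unit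
  NoDup (x ∷ xs) = ¬ (x ∈S xs) × NoDup xs

  Independent : List Carrier → Set (c ⊔ ℓ)
  Independent I = NoDup I × (∀ x y → x ∈S I → y ∈S I → ¬ Adjacent x y)

  MaximalIndependent : List Carrier → Set (c ⊔ ℓ)
  MaximalIndependent I =
    Independent I × (∀ v → ¬ (v ∈S I) → ¬ Independent (v ∷ I))

  WellCovered : Set (c ⊔ ℓ)
  WellCovered = ∀ I J → MaximalIndependent I → MaximalIndependent J →
                length I ≡ length J

prodMat : ∀ {c₁ ℓ₁ c₂ ℓ₂} → FiniteRing c₁ ℓ₁ → FiniteField c₂ ℓ₂ → ℕ →
          RawRing (c₁ ⊔ c₂) (ℓ₁ ⊔ ℓ₂)
prodMat R F n = DP.rawRing (Ring.rawRing (FiniteRing.ring R)) (matRawRing F n)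

{-# OPTIONS --safe #-}
-- Let M = Mₙ(F) with unit group Mˣ, let T be a maximal independent set of Γ(R) and Tᶜ = R ∖ T.
-- Both T × M and (T × (M ∖ Mˣ)) ∪ (Tᶜ × {0}) are maximal independent in Γ(R × M); for the
-- second, every nonzero matrix is the sum of a singular and an invertible matrix. Equal sizes
-- give |R| = |T|(1 + |Mˣ|). If T′ is a maximal independent set of Γ(M) containing 0 and the
-- nilpotent E₁₂, then R × T′ is maximal too, and comparing it with T × M gives
-- |M| = |T′|(1 + |Mˣ|). But M is covered by the closed neighbourhoods t + ({0} ∪ Mˣ), t ∈ T′,
-- and those of 0 and E₁₂ both contain 1, so |M| < |T′|(1 + |Mˣ|).
module Submission where

open import Defs
open import Level using (Level; _⊔_)
open import Function using (_∘′_)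
open import Data.Empty using (⊥)
open import Data.Product using (∃-syntax; _×_; _,_; proj₁; proj₂)
open import Data.Product.Relation.Binary.Pointwise.NonDependent using (_×ₛ_)
open import Data.Sum using (_⊎_; inj₁; inj₂)
open import Data.Nat using (ℕ; zero; suc; _>_; z≤n; s≤s)
import Data.Nat as Nat
import Data.Nat.Properties as ℕₚ
open import Data.Fin as Fin using (Fin)
open import Data.Fin.Properties using (all?; suc-injective; ¬∀⟶∃¬)
open import Data.Vec.Functional as Vector using (Vector; head; tail)
open import Data.Vec.Functional.Relation.Binary.Equality.Setoid using (≋-setoid)
open import Data.List
  using (List; []; _∷_; length; _++_; map; filter; tabulate; concatMap; cartesianProduct; cartesianProductWith)
open import Data.List.Properties using (length-++; length-map; ++-assoc; ++-identityʳ)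
open import Data.List.Relation.Unary.Any as Any using (here; there; any?)
import Data.List.Relation.Unary.All as All
open import Data.List.Relation.Unary.All.Properties using (¬Any⇒All¬; All¬⇒¬Any)
import Data.List.Relation.Unary.AllPairs as AllPairs
open import Data.List.Relation.Unary.Unique.Setoid using (Unique; []; _∷_)
import Data.List.Relation.Unary.Unique.Setoid.Properties as UniqueProperties
import Data.List.Relation.Binary.Equality.Setoid as ListEquality
import Data.List.Relation.Binary.Subset.Setoid as Subset
import Data.List.Membership.Setoid as Membership
open import Data.List.Membership.Setoid.Properties
open import Relation.Nullary using (¬_; Dec; yes; no; contradiction; ¬?; _×-dec_; _⊎-dec_)
open import Relation.Nullary.Decidable using (map′)
open import Relation.Unary using (Pred; Decidable)
open import Relation.Unary.Properties using (∁?)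
open import Relation.Binary using (Setoid)
import Relation.Binary.Definitions as Binary
import Relation.Binary.PropositionalEquality as ≡
open ≡ using (_≡_; _≢_)
open import Algebra.Bundles using (Ring; CommutativeRing)
open import Algebra.Bundles.Raw using (RawRing)
import Algebra.Construct.DirectProduct as DirectProduct

module _ {c ℓ} (S : Setoid c ℓ) where
  open Nat using (_+_; _≤_; _<_)
  open Setoid S
  open Membership S
  open ListEquality S using (_≋_; ≋-length)
  open Subset S using (_⊆_)

  private
    length-∃++ : ∀ {ys as w bs} → ys ≋ as ++ w ∷ bs → length ys ≡ suc (length (as ++ bs))
    length-∃++ {as = as} {w} {bs} ys≋ = ≡.trans (≋-length ys≋) (length-++-∷ as)
      where
      length-++-∷ : ∀ as → length (as ++ w ∷ bs) ≡ suc (length (as ++ bs))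
      length-++-∷ []       = ≡.refl
      length-++-∷ (_ ∷ as) = ≡.cong suc (length-++-∷ as)

    ∈-∃++⁻ : ∀ {ys as w bs z} → ys ≋ as ++ w ∷ bs → z ∈ ys → z ∈ as ++ bs ⊎ z ≈ w
    ∈-∃++⁻ {as = as} ys≋ z∈ys with ∈-++⁻ S as (∈-resp-≋ S ys≋ z∈ys)
    ... | inj₁ z∈as         = inj₁ (∈-++⁺ˡ S z∈as)
    ... | inj₂ (here z≈w)   = inj₂ z≈w
    ... | inj₂ (there z∈bs) = inj₁ (∈-++⁺ʳ S as z∈bs)

  unique∧⊆⇒length≤ : ∀ {xs ys} → Unique S xs → xs ⊆ ys → length xs ≤ length ys
  unique∧⊆⇒length≤ {[]}     _             _     = z≤n
  unique∧⊆⇒length≤ {x ∷ xs} (x∉xs ∷ xs!) xs⊆ys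
    with as , bs , w , x≈w , ys≋ ← ∈-∃++ S (xs⊆ys (here refl)) =
    ≡.subst (suc (length xs) ≤_) (≡.sym (length-∃++ ys≋)) (s≤s (unique∧⊆⇒length≤ xs! xs⊆as++bs))
    where
    xs⊆as++bs : xs ⊆ as ++ bs
    xs⊆as++bs {z} z∈xs with ∈-∃++⁻ ys≋ (xs⊆ys (there z∈xs))
    ... | inj₁ z∈as++bs = z∈as++bs
    ... | inj₂ z≈w      = contradiction (∈-resp-≈ S (trans z≈w (sym x≈w)) z∈xs) (All[≉]⇒∉ S x∉xs)

  unique∧⊆-overlap⇒length< : ∀ {xs ys zs y} → Unique S xs → xs ⊆ ys ++ zs →
                             y ∈ ys → y ∈ zs → length xs < length (ys ++ zs)
  unique∧⊆-overlap⇒length< {xs} {ys} {zs} xs! xs⊆ys++zs y∈ys y∈zs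
    with as , bs , w , y≈w , ys≋ ← ∈-∃++ S y∈ys =
    ≡.subst (suc (length xs) ≤_) length-ys++zs (s≤s (unique∧⊆⇒length≤ xs! xs⊆[as++bs]++zs))
    where
    open ≡.≡-Reasoning
    length-ys++zs : suc (length ((as ++ bs) ++ zs)) ≡ length (ys ++ zs)
    length-ys++zs = begin
      suc (length ((as ++ bs) ++ zs))     ≡⟨ ≡.cong suc (length-++ (as ++ bs)) ⟩
      suc (length (as ++ bs)) + length zs ≡⟨ ≡.cong (_+ length zs) (length-∃++ ys≋) ⟨
      length ys + length zs               ≡⟨ length-++ ys ⟨
      length (ys ++ zs)                   ∎
    xs⊆[as++bs]++zs : xs ⊆ (as ++ bs) ++ zs
    xs⊆[as++bs]++zs {z} z∈xs with ∈-++⁻ S ys (xs⊆ys++zs z∈xs)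
    ... | inj₂ z∈zs = ∈-++⁺ʳ S (as ++ bs) z∈zs
    ... | inj₁ z∈ys with ∈-∃++⁻ ys≋ z∈ys
    ...   | inj₁ z∈as++bs = ∈-++⁺ˡ S z∈as++bs
    ...   | inj₂ z≈w      = ∈-++⁺ʳ S (as ++ bs) (∈-resp-≈ S (trans y≈w (sym z≈w)) y∈zs)

module _ {a} {A : Set a} where
  open Nat using (_+_; _*_)
  open ℕₚ using (+-suc)

  length-filter+length-filter-∁ : ∀ {p} {P : Pred A p} (P? : Decidable P) xs →
    length (filter P? xs) + length (filter (∁? P?) xs) ≡ length xs
  length-filter+length-filter-∁ P? []       = ≡.refl
  length-filter+length-filter-∁ P? (x ∷ xs) with P? x
  ... | yes _ = ≡.cong suc (length-filter+length-filter-∁ P? xs)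
  ... | no  _ = ≡.trans (+-suc _ _) (≡.cong suc (length-filter+length-filter-∁ P? xs))

  length-concatMap-const : ∀ {b} {B : Set b} {f : A → List B} {k} → (∀ x → length (f x) ≡ k) →
    ∀ xs → length (concatMap f xs) ≡ length xs * k
  length-concatMap-const         f-len []       = ≡.refl
  length-concatMap-const {f = f} f-len (x ∷ xs) =
    ≡.trans (length-++ (f x)) (≡.cong₂ _+_ (f-len x) (length-concatMap-const f-len xs))

  length-cartesianProduct : ∀ {b} {B : Set b} (xs : List A) (ys : List B) →
    length (cartesianProduct xs ys) ≡ length xs * length ys
  length-cartesianProduct []       ys = ≡.refl
  length-cartesianProduct (x ∷ xs) ys =
    ≡.trans (length-++ (map (x ,_) ys))
            (≡.cong₂ _+_ (length-map (x ,_) ys) (length-cartesianProduct xs ys))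

record Enumeration {c ℓ} (S : Setoid c ℓ) : Set (c ⊔ ℓ) where
  open Setoid S
  open Membership S
  infix 4 _≟_
  field
    _≟_      : Binary.Decidable _≈_
    elements : List Carrier
    unique   : Unique S elements
    complete : ∀ x → x ∈ elements

module _ {c ℓ} (S : Setoid c ℓ) where
  open Setoid S

  isFiniteCarrier⇒enumeration : IsFiniteCarrier _≈_ → Enumeration S
  isFiniteCarrier⇒enumeration (k , enum , surjective , injective) = record
    { _≟_      = _≟_
    ; elements = tabulate enum
    ; unique   = UniqueProperties.tabulate⁺ S (injective _ _)
    ; complete = λ x → let i , enumᵢ≈x = surjective x in ∈-resp-≈ S enumᵢ≈x (∈-tabulate⁺ S i)
    }
    where
    _≟_ : Binary.Decidable _≈_
    x ≟ y with surjective x | surjective y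
    ... | i , enumᵢ≈x | j , enumⱼ≈y =
      map′ (λ { ≡.refl → trans (sym enumᵢ≈x) enumⱼ≈y })
           (λ x≈y → injective i j (trans enumᵢ≈x (trans x≈y (sym enumⱼ≈y))))
           (i Fin.≟ j)

module _ {c ℓ} {S : Setoid c ℓ} (E : Enumeration S) where
  open Setoid S
  open Enumeration E

  private
    vectors : ∀ m → List (Vector Carrier m)
    vectors zero    = Vector.[] ∷ []
    vectors (suc m) = cartesianProductWith Vector._∷_ elements (vectors m)

    vectors-unique : ∀ m → Unique (≋-setoid S m) (vectors m)
    vectors-unique zero    = All.[] AllPairs.∷ AllPairs.[]
    vectors-unique (suc m) =
      UniqueProperties.cartesianProductWith⁺ S (≋-setoid S m) (≋-setoid S (suc m)) Vector._∷_
        (λ x∷xs≋y∷ys → x∷xs≋y∷ys Fin.zero , λ i → x∷xs≋y∷ys (Fin.suc i))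
        unique (vectors-unique m)

    vectors-complete : ∀ m v → Membership._∈_ (≋-setoid S m) v (vectors m)
    vectors-complete zero    v = here (λ ())
    vectors-complete (suc m) v =
      ∈-resp-≈ (≋-setoid S (suc m)) head∷tail≋v
        (∈-cartesianProductWith⁺ S (≋-setoid S m) (≋-setoid S (suc m)) ∷-cong
          (complete (head v)) (vectors-complete m (tail v)))
      where
      head∷tail≋v : ∀ i → (head v Vector.∷ tail v) i ≈ v i
      head∷tail≋v Fin.zero    = refl
      head∷tail≋v (Fin.suc i) = refl
      ∷-cong : ∀ {x y} {xs ys : Vector Carrier m} → x ≈ y → (∀ i → xs i ≈ ys i) →
               ∀ i → (x Vector.∷ xs) i ≈ (y Vector.∷ ys) i
      ∷-cong x≈y xs≋ys Fin.zero    = x≈y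
      ∷-cong x≈y xs≋ys (Fin.suc i) = xs≋ys i

  vectorEnumeration : ∀ m → Enumeration (≋-setoid S m)
  vectorEnumeration m = record
    { _≟_      = λ u v → all? (λ i → u i ≟ v i)
    ; elements = vectors m
    ; unique   = vectors-unique m
    ; complete = vectors-complete m
    }

module Units {c ℓ} (R : Ring c ℓ) where
  open Ring R
  open import Algebra.Properties.Ring R using (-‿distribʳ-*; -‿distribˡ-*; -‿involutive; [y-z]x≈yx-zx)
  open import Algebra.Properties.AbelianGroup +-abelianGroup
    using (ε⁻¹≈ε; ⁻¹-anti-homo‿-; //-rightDividesˡ)
  open import Relation.Binary.Reasoning.Setoid setoid

  Unit : Carrier → Set (c ⊔ ℓ)
  Unit = IsUnit rawRing

  unit-cong : ∀ {x y} → x ≈ y → Unit x → Unit y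
  unit-cong x≈y (v , xv≈1 , vx≈1) =
    v , trans (*-congʳ (sym x≈y)) xv≈1 , trans (*-congˡ (sym x≈y)) vx≈1

  1#-unit : Unit 1#
  1#-unit = 1# , *-identityˡ 1# , *-identityˡ 1#

  *-unit : ∀ {x y} → Unit x → Unit y → Unit (x * y)
  *-unit {x} {y} (u , xu≈1 , ux≈1) (v , yv≈1 , vy≈1) =
    v * u , cancel x y v u yv≈1 xu≈1 , cancel v u x y ux≈1 vy≈1
    where
    cancel : ∀ a b c d → b * c ≈ 1# → a * d ≈ 1# → a * b * (c * d) ≈ 1#
    cancel a b c d bc≈1 ad≈1 = begin
      a * b * (c * d)   ≈⟨ *-assoc a b (c * d) ⟩
      a * (b * (c * d)) ≈⟨ *-congˡ (*-assoc b c d) ⟨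
      a * (b * c * d)   ≈⟨ *-congˡ (*-congʳ bc≈1) ⟩
      a * (1# * d)      ≈⟨ *-congˡ (*-identityˡ d) ⟩
      a * d             ≈⟨ ad≈1 ⟩
      1#                ∎

  unit-difference-sym : ∀ {x y} → Unit (x - y) → Unit (y - x)
  unit-difference-sym {x} {y} (v , p , q) = unit-cong (⁻¹-anti-homo‿- x y) (- v , neg p , neg q)
    where
    neg : ∀ {a b} → a * b ≈ 1# → - a * - b ≈ 1#
    neg {a} {b} ab≈1 = begin
      - a * - b     ≈⟨ -‿distribˡ-* a (- b) ⟨
      - (a * - b)   ≈⟨ -‿cong (-‿distribʳ-* a b) ⟨
      - - (a * b)   ≈⟨ -‿involutive (a * b) ⟩
      a * b         ≈⟨ ab≈1 ⟩
      1#            ∎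

  x+[y-x]≈y : ∀ x y → x + (y - x) ≈ y
  x+[y-x]≈y x y = trans (+-comm x (y - x)) (//-rightDividesˡ x y)

  x-[x-y]≈y : ∀ x y → x - (x - y) ≈ y
  x-[x-y]≈y x y = trans (+-congˡ (⁻¹-anti-homo‿- x y)) (x+[y-x]≈y x y)

  y≈0⇒x-y≈x : ∀ x {y} → y ≈ 0# → x - y ≈ x
  y≈0⇒x-y≈x x y≈0 = trans (+-congˡ (trans (-‿cong y≈0) ε⁻¹≈ε)) (+-identityʳ x)

  0#-nonunit : ¬ 1# ≈ 0# → ¬ Unit 0#
  0#-nonunit 1≉0 (v , 0v≈1 , _) = 1≉0 (trans (sym 0v≈1) (zeroˡ v))

  square-zero⇒nonunit : ∀ {N} → ¬ N ≈ 0# → N * N ≈ 0# → ¬ Unit N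
  square-zero⇒nonunit {N} N≉0 N²≈0 (v , Nv≈1 , _) = N≉0 (begin
    N             ≈⟨ *-identityʳ N ⟨
    N * 1#        ≈⟨ *-congˡ Nv≈1 ⟨
    N * (N * v)   ≈⟨ *-assoc N N v ⟨
    N * N * v     ≈⟨ *-congʳ N²≈0 ⟩
    0# * v        ≈⟨ zeroˡ v ⟩
    0#            ∎)

  HasNonunitNeighbour : Carrier → Set (c ⊔ ℓ)
  HasNonunitNeighbour B = ∃[ A ] (¬ Unit A × Unit (B - A))

  nonunit-neighbour-*ʳ : ∀ {B Q} → Unit Q → HasNonunitNeighbour (B * Q) → HasNonunitNeighbour B
  nonunit-neighbour-*ʳ {B} {Q} (W , QW≈1 , WQ≈1) (A , A-nonunit , BQ-A-unit) =
    A * W , AW-nonunit , unit-cong [BQ-A]W≈B-AW (*-unit BQ-A-unit (Q , WQ≈1 , QW≈1))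
    where
    cancel : ∀ X {Y Z} → Y * Z ≈ 1# → X * Y * Z ≈ X
    cancel X {Y} {Z} YZ≈1 = trans (*-assoc X Y Z) (trans (*-congˡ YZ≈1) (*-identityʳ X))
    AW-nonunit : ¬ Unit (A * W)
    AW-nonunit AW-unit = A-nonunit (unit-cong (cancel A WQ≈1) (*-unit AW-unit (W , QW≈1 , WQ≈1)))
    [BQ-A]W≈B-AW : (B * Q - A) * W ≈ B - A * W
    [BQ-A]W≈B-AW = trans ([y-z]x≈yx-zx W (B * Q) A) (+-congʳ (cancel B QW≈1))

  private
    [1+a][1+b]≈1 : ∀ {a b} → a + b ≈ 0# → a * b ≈ 0# → (1# + a) * (1# + b) ≈ 1#
    [1+a][1+b]≈1 {a} {b} a+b≈0 ab≈0 = begin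
      (1# + a) * (1# + b)             ≈⟨ distribʳ (1# + b) 1# a ⟩
      1# * (1# + b) + a * (1# + b)    ≈⟨ +-cong (*-identityˡ (1# + b)) (distribˡ a 1# b) ⟩
      1# + b + (a * 1# + a * b)       ≈⟨ +-congˡ (+-cong (*-identityʳ a) ab≈0) ⟩
      1# + b + (a + 0#)               ≈⟨ +-congˡ (+-identityʳ a) ⟩
      1# + b + a                      ≈⟨ +-assoc 1# b a ⟩
      1# + (b + a)                    ≈⟨ +-congˡ (trans (+-comm b a) a+b≈0) ⟩
      1# + 0#                         ≈⟨ +-identityʳ 1# ⟩
      1#                              ∎

  module _ {N} (N²≈0 : N * N ≈ 0#) where
    private
      -N²≈0 : - (N * N) ≈ 0#
      -N²≈0 = trans (-‿cong N²≈0) ε⁻¹≈ε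
      [1+N][1-N]≈1 : (1# + N) * (1# - N) ≈ 1#
      [1+N][1-N]≈1 = [1+a][1+b]≈1 (-‿inverseʳ N) (trans (sym (-‿distribʳ-* N N)) -N²≈0)
      [1-N][1+N]≈1 : (1# - N) * (1# + N) ≈ 1#
      [1-N][1+N]≈1 = [1+a][1+b]≈1 (-‿inverseˡ N) (trans (sym (-‿distribˡ-* N N)) -N²≈0)

    square-zero⇒1+unit : Unit (1# + N)
    square-zero⇒1+unit = 1# - N , [1+N][1-N]≈1 , [1-N][1+N]≈1

    square-zero⇒1-unit : Unit (1# - N)
    square-zero⇒1-unit = 1# + N , [1-N][1+N]≈1 , [1+N][1-N]≈1

module CayleyGraph {c ℓ} (R : Ring c ℓ) where
  open Ring R
  open Units R
  open Membership setoid
  open import Algebra.Properties.AbelianGroup +-abelianGroup using (x≈y⇒x∙y⁻¹≈ε)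

  unique⇒noDup : ∀ {xs} → Unique setoid xs → NoDup rawRing xs
  unique⇒noDup []            = Level.lift _
  unique⇒noDup (x≉xs ∷ xs!) = All¬⇒¬Any x≉xs , unique⇒noDup xs!

  noDup⇒unique : ∀ {xs} → NoDup rawRing xs → Unique setoid xs
  noDup⇒unique {[]}    _              = AllPairs.[]
  noDup⇒unique {_ ∷ _} (x∉xs , xs-nd) = ¬Any⇒All¬ _ x∉xs AllPairs.∷ noDup⇒unique xs-nd

  adjacent-sym : ∀ {x y} → Adjacent rawRing x y → Adjacent rawRing y x
  adjacent-sym (x≉y , u) = (λ y≈x → x≉y (sym y≈x)) , unit-difference-sym u

  adjacent-resp : ∀ {x x′ y y′} → x ≈ x′ → y ≈ y′ → Adjacent rawRing x y → Adjacent rawRing x′ y′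
  adjacent-resp x≈x′ y≈y′ (x≉y , u) =
    (λ x′≈y′ → x≉y (trans x≈x′ (trans x′≈y′ (sym y≈y′)))) ,
    unit-cong (+-cong x≈x′ (-‿cong y≈y′)) u

  unit-difference⇒adjacent : ¬ 1# ≈ 0# → ∀ {x y} → Unit (x - y) → Adjacent rawRing x y
  unit-difference⇒adjacent 1≉0 u = (λ x≈y → 0#-nonunit 1≉0 (unit-cong (x≈y⇒x∙y⁻¹≈ε x≈y) u)) , u

  independent⇒nonunit-difference : ¬ 1# ≈ 0# → ∀ {I x y} → Independent rawRing I →
                                   x ∈ I → y ∈ I → ¬ Unit (x - y)
  independent⇒nonunit-difference 1≉0 (_ , nonadjacent) x∈I y∈I u =
    nonadjacent _ _ x∈I y∈I (unit-difference⇒adjacent 1≉0 u)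

  independent-[] : Independent rawRing []
  independent-[] = Level.lift _ , λ _ _ ()

  independent-snoc : ∀ {I v} → Independent rawRing I → ¬ v ∈ I →
                     (∀ w → w ∈ I → ¬ Adjacent rawRing v w) → Independent rawRing (I ++ v ∷ [])
  independent-snoc {I} {v} (I-nd , I-nonadjacent) v∉I v-nonadjacent = noDup-snoc I-nd v∉I , nonadjacent
    where
    ∈-snoc⁻ : ∀ {x} → x ∈ I ++ v ∷ [] → x ∈ I ⊎ x ≈ v
    ∈-snoc⁻ x∈ with ∈-++⁻ setoid I x∈
    ... | inj₁ x∈I      = inj₁ x∈I
    ... | inj₂ (here x≈v) = inj₂ x≈v
    noDup-snoc : ∀ {J} → NoDup rawRing J → ¬ v ∈ J → NoDup rawRing (J ++ v ∷ [])
    noDup-snoc {[]}    _              _   = (λ ()) , Level.lift _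
    noDup-snoc {x ∷ J} (x∉J , J-nd) v∉x∷J = x∉J++v , noDup-snoc J-nd (v∉x∷J ∘′ there)
      where
      x∉J++v : ¬ x ∈ J ++ v ∷ []
      x∉J++v x∈ with ∈-++⁻ setoid J x∈
      ... | inj₁ x∈J        = x∉J x∈J
      ... | inj₂ (here x≈v) = v∉x∷J (here (sym x≈v))
    nonadjacent : ∀ x y → x ∈ I ++ v ∷ [] → y ∈ I ++ v ∷ [] → ¬ Adjacent rawRing x y
    nonadjacent x y x∈ y∈ with ∈-snoc⁻ x∈ | ∈-snoc⁻ y∈
    ... | inj₁ x∈I | inj₁ y∈I = I-nonadjacent x y x∈I y∈I
    ... | inj₂ x≈v | inj₁ y∈I = v-nonadjacent y y∈I ∘′ adjacent-resp x≈v refl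
    ... | inj₁ x∈I | inj₂ y≈v = v-nonadjacent x x∈I ∘′ adjacent-sym ∘′ adjacent-resp refl y≈v
    ... | inj₂ x≈v | inj₂ y≈v = λ (x≉y , _) → x≉y (trans x≈v (sym y≈v))

  Dominated : List Carrier → Carrier → Set (c ⊔ ℓ)
  Dominated J v = v ∈ J ⊎ ∃[ w ] (w ∈ J × Adjacent rawRing v w)

  Dominating : List Carrier → Set (c ⊔ ℓ)
  Dominating J = ∀ v → Dominated J v

  dominated-resp : ∀ {J v v′} → v ≈ v′ → Dominated J v → Dominated J v′
  dominated-resp v≈v′ (inj₁ v∈J)            = inj₁ (∈-resp-≈ setoid v≈v′ v∈J)
  dominated-resp v≈v′ (inj₂ (w , w∈J , adj)) = inj₂ (w , w∈J , adjacent-resp v≈v′ refl adj)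

  dominated-++⁺ˡ : ∀ {J v} K → Dominated J v → Dominated (J ++ K) v
  dominated-++⁺ˡ K (inj₁ v∈J)            = inj₁ (∈-++⁺ˡ setoid v∈J)
  dominated-++⁺ˡ K (inj₂ (w , w∈J , adj)) = inj₂ (w , ∈-++⁺ˡ setoid w∈J , adj)

  independent∧dominating⇒maximal : ∀ {J} → Independent rawRing J → Dominating J →
                                   MaximalIndependent rawRing J
  independent∧dominating⇒maximal J-independent J-dominating = J-independent , maximal
    where
    maximal : ∀ v → ¬ v ∈ _ → ¬ Independent rawRing (v ∷ _)
    maximal v v∉J (_ , nonadjacent) with J-dominating v
    ... | inj₁ v∈J              = v∉J v∈J
    ... | inj₂ (w , w∈J , adj) = nonadjacent v w (here refl) (there w∈J) adj

module GreedyExtension {c ℓ} (R : Ring c ℓ) (E : Enumeration (Ring.setoid R)) where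
  open Ring R
  open Units R
  open CayleyGraph R
  open Enumeration E
  open Membership setoid

  unit? : Decidable Unit
  unit? x = map′ Any.satisfied (λ (v , p , q) → Any.map (inverse-resp p q) (complete v))
                 (any? (λ v → (x * v ≟ 1#) ×-dec (v * x ≟ 1#)) elements)
    where
    inverse-resp : ∀ {v w} → x * v ≈ 1# → v * x ≈ 1# → v ≈ w → x * w ≈ 1# × w * x ≈ 1#
    inverse-resp xv≈1 vx≈1 v≈w = trans (*-congˡ (sym v≈w)) xv≈1 , trans (*-congʳ (sym v≈w)) vx≈1

  adjacent? : ∀ x y → Dec (Adjacent rawRing x y)
  adjacent? x y = ¬? (x ≟ y) ×-dec unit? (x - y)

  _∈?_ : ∀ x xs → Dec (x ∈ xs)
  x ∈? xs = any? (x ≟_) xs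

  dominated? : ∀ J v → Dec (Dominated J v)
  dominated? J v = v ∈? J ⊎-dec map′ find (λ (w , w∈J , adj) → lose (adjacent-resp refl) w∈J adj)
                                         (any? (adjacent? v) J)

  additions : List Carrier → List Carrier → List Carrier
  additions I []       = []
  additions I (v ∷ vs) with dominated? I v
  ... | yes _ = additions I vs
  ... | no  _ = v ∷ additions (I ++ v ∷ []) vs

  additions-independent : ∀ {I} vs → Independent rawRing I → Independent rawRing (I ++ additions I vs)
  additions-independent {I} []       I-independent =
    ≡.subst (Independent rawRing) (≡.sym (++-identityʳ I)) I-independent
  additions-independent {I} (v ∷ vs) I-independent with dominated? I v
  ... | yes _      = additions-independent vs I-independent
  ... | no  ¬v-dom = ≡.subst (Independent rawRing) (++-assoc I (v ∷ []) _)
      (additions-independent vs (independent-snoc I-independent (¬v-dom ∘′ inj₁)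
        (λ w w∈I adj → ¬v-dom (inj₂ (w , w∈I , adj)))))

  additions-dominate : ∀ I {vs v} → v ∈ vs → Dominated (I ++ additions I vs) v
  additions-dominate I {u ∷ vs} v∈u∷vs with dominated? I u | v∈u∷vs
  ... | yes u-dom | here v≈u   = dominated-resp (sym v≈u) (dominated-++⁺ˡ _ u-dom)
  ... | yes _     | there v∈vs = additions-dominate I v∈vs
  ... | no  _     | here v≈u   = inj₁ (∈-++⁺ʳ setoid I (here v≈u))
  ... | no  _     | there v∈vs =
    ≡.subst (λ J → Dominated J _) (++-assoc I (u ∷ []) _) (additions-dominate (I ++ u ∷ []) v∈vs)

  extend : List Carrier → List Carrier
  extend I = I ++ additions I elements

  extend-independent : ∀ {I} → Independent rawRing I → Independent rawRing (extend I)
  extend-independent = additions-independent elements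

  extend-dominating : ∀ I → Dominating (extend I)
  extend-dominating I v = additions-dominate I (complete v)

module _ {c₁ ℓ₁ c₂ ℓ₂} (R₁ : Ring c₁ ℓ₁) (R₂ : Ring c₂ ℓ₂) where
  private
    R₁×R₂ = DirectProduct.ring R₁ R₂
    module R₁ = Ring R₁
    module R₂ = Ring R₂
    module P = Ring R₁×R₂
    module U₁ = Units R₁
    module U₂ = Units R₂
    module UP = Units R₁×R₂
    module Γ₁ = CayleyGraph R₁
    module Γ₂ = CayleyGraph R₂
    module ΓP = CayleyGraph R₁×R₂
    open Membership R₁.setoid using () renaming (_∈_ to _∈₁_)
    open Membership R₂.setoid using () renaming (_∈_ to _∈₂_)

  ×-unit⁺ : ∀ {a b} → U₁.Unit a → U₂.Unit b → UP.Unit (a , b)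
  ×-unit⁺ (v , av≈1 , va≈1) (w , bw≈1 , wb≈1) = (v , w) , (av≈1 , bw≈1) , (va≈1 , wb≈1)

  ×-unit⁻ : ∀ {a b} → UP.Unit (a , b) → U₁.Unit a × U₂.Unit b
  ×-unit⁻ ((v , w) , (av≈1 , bw≈1) , (va≈1 , wb≈1)) = (v , av≈1 , va≈1) , (w , bw≈1 , wb≈1)

  adjacent-×⁺ˡ : ∀ {x₁ x₂ y₁ y₂} → Adjacent R₁.rawRing x₁ y₁ → U₂.Unit (x₂ R₂.- y₂) →
                 Adjacent P.rawRing (x₁ , x₂) (y₁ , y₂)
  adjacent-×⁺ˡ (x₁≉y₁ , u₁) u₂ = x₁≉y₁ ∘′ proj₁ , ×-unit⁺ u₁ u₂

  adjacent-×⁺ʳ : ∀ {x₁ x₂ y₁ y₂} → U₁.Unit (x₁ R₁.- y₁) → Adjacent R₂.rawRing x₂ y₂ →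
                 Adjacent P.rawRing (x₁ , x₂) (y₁ , y₂)
  adjacent-×⁺ʳ u₁ (x₂≉y₂ , u₂) = x₂≉y₂ ∘′ proj₂ , ×-unit⁺ u₁ u₂

  cartesianProduct-independentˡ : ¬ R₁.1# R₁.≈ R₁.0# → ∀ {I ys} → Independent R₁.rawRing I →
    Unique R₂.setoid ys → Independent P.rawRing (cartesianProduct I ys)
  cartesianProduct-independentˡ 1≉0 {I} {ys} I-independent ys! =
    ΓP.unique⇒noDup (UniqueProperties.cartesianProduct⁺ R₁.setoid R₂.setoid
      (Γ₁.noDup⇒unique (proj₁ I-independent)) ys!) ,
    λ x y x∈ y∈ (_ , u) → Γ₁.independent⇒nonunit-difference 1≉0 I-independent
      (proj₁ (∈-cartesianProduct⁻ R₁.setoid R₂.setoid I ys x∈))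
      (proj₁ (∈-cartesianProduct⁻ R₁.setoid R₂.setoid I ys y∈)) (proj₁ (×-unit⁻ u))

  cartesianProduct-independentʳ : ¬ R₂.1# R₂.≈ R₂.0# → ∀ {xs J} → Unique R₁.setoid xs →
    Independent R₂.rawRing J → Independent P.rawRing (cartesianProduct xs J)
  cartesianProduct-independentʳ 1≉0 {xs} {J} xs! J-independent =
    ΓP.unique⇒noDup (UniqueProperties.cartesianProduct⁺ R₁.setoid R₂.setoid
      xs! (Γ₂.noDup⇒unique (proj₁ J-independent))) ,
    λ x y x∈ y∈ (_ , u) → Γ₂.independent⇒nonunit-difference 1≉0 J-independent
      (proj₂ (∈-cartesianProduct⁻ R₁.setoid R₂.setoid xs J x∈))
      (proj₂ (∈-cartesianProduct⁻ R₁.setoid R₂.setoid xs J y∈)) (proj₂ (×-unit⁻ u))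

  cartesianProduct-dominatingˡ : ∀ {I ys} → Γ₁.Dominating I → (∀ y → y ∈₂ ys) →
                                 ΓP.Dominating (cartesianProduct I ys)
  cartesianProduct-dominatingˡ I-dominating ys-complete (x₁ , x₂) with I-dominating x₁
  ... | inj₁ x₁∈I             = inj₁ (∈-cartesianProduct⁺ R₁.setoid R₂.setoid x₁∈I (ys-complete x₂))
  ... | inj₂ (w , w∈I , adj) =
    inj₂ ((w , x₂ R₂.- R₂.1#) , ∈-cartesianProduct⁺ R₁.setoid R₂.setoid w∈I (ys-complete _) ,
          adjacent-×⁺ˡ adj (U₂.unit-cong (R₂.sym (U₂.x-[x-y]≈y x₂ R₂.1#)) U₂.1#-unit))

  cartesianProduct-dominatingʳ : ∀ {xs J} → (∀ x → x ∈₁ xs) → Γ₂.Dominating J →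
                                 ΓP.Dominating (cartesianProduct xs J)
  cartesianProduct-dominatingʳ xs-complete J-dominating (x₁ , x₂) with J-dominating x₂
  ... | inj₁ x₂∈J             = inj₁ (∈-cartesianProduct⁺ R₁.setoid R₂.setoid (xs-complete x₁) x₂∈J)
  ... | inj₂ (w , w∈J , adj) =
    inj₂ ((x₁ R₁.- R₁.1# , w) , ∈-cartesianProduct⁺ R₁.setoid R₂.setoid (xs-complete _) w∈J ,
          adjacent-×⁺ʳ (U₁.unit-cong (R₁.sym (U₁.x-[x-y]≈y x₁ R₁.1#)) U₁.1#-unit) adj)

module _ where
  open Nat using (_+_; _*_; _<_)
  open ℕₚ using (+-comm; *-comm; *-assoc; *-suc; *-distribˡ-+; +-cancelˡ-≡; *-cancelˡ-≡; <-irrefl)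
  open ≡.≡-Reasoning

  -- Read t = |T|, u = |Tᶜ|, k = |T′|, and g, s for the numbers of units and nonunits of M.
  counting-contradiction : ∀ t₀ {g s u k} → let t = suc t₀ in
    t * (g + s) ≡ t * s + u → t * (g + s) ≡ (t + u) * k → g + s < k * suc g → ⊥
  counting-contradiction t₀ {g} {s} {u} {k} |T×M|≡|T×S∪Tᶜ×0| |T×M|≡|R×T′| g+s<k[1+g] =
    <-irrefl g+s≡k[1+g] g+s<k[1+g]
    where
    t : ℕ
    t = suc t₀
    u≡tg : u ≡ t * g
    u≡tg = +-cancelˡ-≡ (t * s) u (t * g) (begin
      t * s + u     ≡⟨ |T×M|≡|T×S∪Tᶜ×0| ⟨
      t * (g + s)   ≡⟨ *-distribˡ-+ t g s ⟩
      t * g + t * s ≡⟨ +-comm (t * g) (t * s) ⟩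
      t * s + t * g ∎)
    g+s≡k[1+g] : g + s ≡ k * suc g
    g+s≡k[1+g] = *-cancelˡ-≡ (g + s) (k * suc g) t (begin
      t * (g + s)       ≡⟨ |T×M|≡|R×T′| ⟩
      (t + u) * k       ≡⟨ ≡.cong (λ x → (t + x) * k) u≡tg ⟩
      (t + t * g) * k   ≡⟨ ≡.cong (_* k) (*-suc t g) ⟨
      t * suc g * k     ≡⟨ *-assoc t (suc g) k ⟩
      t * (suc g * k)   ≡⟨ ≡.cong (t *_) (*-comm (suc g) k) ⟩
      t * (k * suc g)   ∎)

module _ {c₁ ℓ₁ c₂ ℓ₂} (R : Ring c₁ ℓ₁) (M : Ring c₂ ℓ₂)
         (Rᴱ : Enumeration (Ring.setoid R)) (Mᴱ : Enumeration (Ring.setoid M))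
         (1≉0ᴿ : ¬ Ring._≈_ R (Ring.1# R) (Ring.0# R)) (1≉0ᴹ : ¬ Ring._≈_ M (Ring.1# M) (Ring.0# M))
         where
  private
    R×M = DirectProduct.ring R M
    module R = Ring R
    module M = Ring M
    module Rᴱ = Enumeration Rᴱ
    module Mᴱ = Enumeration Mᴱ
    module Uᴿ = Units R
    module Uᴹ = Units M
    module Γᴿ = CayleyGraph R
    module Γᴹ = CayleyGraph M
    module ΓP = CayleyGraph R×M
    module Gᴿ = GreedyExtension R Rᴱ
    module Gᴹ = GreedyExtension M Mᴱ
    open Membership R.setoid using () renaming (_∈_ to _∈ᴿ_)
    open Membership M.setoid using () renaming (_∈_ to _∈ᴹ_)

    Sᴾ : Setoid (c₁ ⊔ c₂) (ℓ₁ ⊔ ℓ₂)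
    Sᴾ = R.setoid ×ₛ M.setoid
    open Membership Sᴾ using () renaming (_∈_ to _∈ᴾ_)

    Adjacentᴾ : R.Carrier × M.Carrier → R.Carrier × M.Carrier → Set (c₁ ⊔ c₂ ⊔ ℓ₁ ⊔ ℓ₂)
    Adjacentᴾ = Adjacent (Ring.rawRing R×M)

    open Nat using (_+_; _*_; _<_)

    nonunitᴹ-difference⇒nonadjacent : ∀ {x y} → ¬ Uᴹ.Unit (proj₂ x M.- proj₂ y) → ¬ Adjacentᴾ x y
    nonunitᴹ-difference⇒nonadjacent nonunit (_ , u) = nonunit (proj₂ (×-unit⁻ R M u))

  T : List R.Carrier
  T = Gᴿ.extend (R.0# ∷ [])

  T-independent : Independent R.rawRing T
  T-independent = Gᴿ.extend-independent (Γᴿ.independent-snoc Γᴿ.independent-[] (λ ()) (λ _ ()))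

  T-dominating : Γᴿ.Dominating T
  T-dominating = Gᴿ.extend-dominating _

  T×M-maximal : MaximalIndependent (Ring.rawRing R×M) (cartesianProduct T Mᴱ.elements)
  T×M-maximal = ΓP.independent∧dominating⇒maximal
    (cartesianProduct-independentˡ R M 1≉0ᴿ T-independent Mᴱ.unique)
    (cartesianProduct-dominatingˡ R M T-dominating Mᴱ.complete)

  unitsᴹ : List M.Carrier
  unitsᴹ = filter Gᴹ.unit? Mᴱ.elements

  nonunitsᴹ : List M.Carrier
  nonunitsᴹ = filter (∁? Gᴹ.unit?) Mᴱ.elements

  Tᶜ : List R.Carrier
  Tᶜ = filter (∁? (Gᴿ._∈? T)) Rᴱ.elements

  T×nonunits∪Tᶜ×0 : List (R.Carrier × M.Carrier)
  T×nonunits∪Tᶜ×0 = cartesianProduct T nonunitsᴹ ++ cartesianProduct Tᶜ (M.0# ∷ [])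

  private
    nonunit-resp : ∀ {x y} → x M.≈ y → ¬ Uᴹ.Unit x → ¬ Uᴹ.Unit y
    nonunit-resp x≈y x-nonunit = x-nonunit ∘′ Uᴹ.unit-cong (M.sym x≈y)

    nonunit-minus-zero : ∀ {A B} → ¬ Uᴹ.Unit A → B M.≈ M.0# → ¬ Uᴹ.Unit (A M.- B)
    nonunit-minus-zero A-nonunit B≈0 = nonunit-resp (M.sym (Uᴹ.y≈0⇒x-y≈x _ B≈0)) A-nonunit

    ∈-T×nonunits⁻ : ∀ {x} → x ∈ᴾ cartesianProduct T nonunitsᴹ →
                    proj₁ x ∈ᴿ T × ¬ Uᴹ.Unit (proj₂ x)
    ∈-T×nonunits⁻ x∈
      with x₁∈T , x₂∈nonunits ← ∈-cartesianProduct⁻ R.setoid M.setoid T nonunitsᴹ x∈ =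
      x₁∈T , proj₂ (∈-filter⁻ M.setoid (∁? Gᴹ.unit?) nonunit-resp {xs = Mᴱ.elements} x₂∈nonunits)

    ∈-Tᶜ×0⁻ : ∀ {x} → x ∈ᴾ cartesianProduct Tᶜ (M.0# ∷ []) →
              ¬ proj₁ x ∈ᴿ T × proj₂ x M.≈ M.0#
    ∈-Tᶜ×0⁻ x∈
      with x₁∈Tᶜ , here x₂≈0 ← ∈-cartesianProduct⁻ R.setoid M.setoid Tᶜ (M.0# ∷ []) x∈ =
      proj₂ (∈-filter⁻ R.setoid (∁? (Gᴿ._∈? T)) (∉-resp-≈ R.setoid) {xs = Rᴱ.elements} x₁∈Tᶜ) ,
      x₂≈0

  T×nonunits∪Tᶜ×0-independent : Independent (Ring.rawRing R×M) T×nonunits∪Tᶜ×0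
  T×nonunits∪Tᶜ×0-independent =
    ΓP.unique⇒noDup (UniqueProperties.++⁺ Sᴾ T×nonunits! Tᶜ×0! disjoint) , nonadjacent
    where
    T×nonunits! : Unique Sᴾ (cartesianProduct T nonunitsᴹ)
    T×nonunits! = UniqueProperties.cartesianProduct⁺ R.setoid M.setoid
      (Γᴿ.noDup⇒unique (proj₁ T-independent)) (UniqueProperties.filter⁺ M.setoid _ Mᴱ.unique)
    Tᶜ×0! : Unique Sᴾ (cartesianProduct Tᶜ (M.0# ∷ []))
    Tᶜ×0! = UniqueProperties.cartesianProduct⁺ R.setoid M.setoid
      (UniqueProperties.filter⁺ R.setoid _ Rᴱ.unique) (All.[] AllPairs.∷ AllPairs.[])
    disjoint : ∀ {v} → ¬ (v ∈ᴾ cartesianProduct T nonunitsᴹ × v ∈ᴾ cartesianProduct Tᶜ (M.0# ∷ []))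
    disjoint (v∈T×nonunits , v∈Tᶜ×0) =
      proj₁ (∈-Tᶜ×0⁻ v∈Tᶜ×0) (proj₁ (∈-T×nonunits⁻ v∈T×nonunits))
    nonadjacent : ∀ x y → x ∈ᴾ T×nonunits∪Tᶜ×0 → y ∈ᴾ T×nonunits∪Tᶜ×0 → ¬ Adjacentᴾ x y
    nonadjacent x y x∈ y∈
      with ∈-++⁻ Sᴾ (cartesianProduct T nonunitsᴹ) x∈
         | ∈-++⁻ Sᴾ (cartesianProduct T nonunitsᴹ) y∈
    ... | inj₁ x∈l | inj₁ y∈l = λ (_ , u) → Γᴿ.independent⇒nonunit-difference 1≉0ᴿ T-independent
            (proj₁ (∈-T×nonunits⁻ x∈l)) (proj₁ (∈-T×nonunits⁻ y∈l)) (proj₁ (×-unit⁻ R M u))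
    ... | inj₁ x∈l | inj₂ y∈r = nonunitᴹ-difference⇒nonadjacent
            (nonunit-minus-zero (proj₂ (∈-T×nonunits⁻ x∈l)) (proj₂ (∈-Tᶜ×0⁻ y∈r)))
    ... | inj₂ x∈r | inj₁ y∈l = nonunitᴹ-difference⇒nonadjacent
            (nonunit-minus-zero (proj₂ (∈-T×nonunits⁻ y∈l)) (proj₂ (∈-Tᶜ×0⁻ x∈r)) ∘′ Uᴹ.unit-difference-sym)
    ... | inj₂ x∈r | inj₂ y∈r = nonunitᴹ-difference⇒nonadjacent
            (nonunit-minus-zero (nonunit-resp (M.sym (proj₂ (∈-Tᶜ×0⁻ x∈r))) (Uᴹ.0#-nonunit 1≉0ᴹ))
                                (proj₂ (∈-Tᶜ×0⁻ y∈r)))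

  T×nonunits∪Tᶜ×0-dominating : (∀ B → ¬ B M.≈ M.0# → Uᴹ.HasNonunitNeighbour B) →
                               ΓP.Dominating T×nonunits∪Tᶜ×0
  T×nonunits∪Tᶜ×0-dominating nonzero⇒nonunit-neighbour (s , B) with s Gᴿ.∈? T
  ... | yes s∈T = dominated-if-∈T s∈T (Gᴹ.unit? B)
    where
    dominated-if-∈T : s ∈ᴿ T → Dec (Uᴹ.Unit B) → ΓP.Dominated T×nonunits∪Tᶜ×0 (s , B)
    dominated-if-∈T s∈T (no B-nonunit) = inj₁ (∈-++⁺ˡ Sᴾ
      (∈-cartesianProduct⁺ R.setoid M.setoid s∈T
        (∈-filter⁺ M.setoid (∁? Gᴹ.unit?) nonunit-resp (Mᴱ.complete B) B-nonunit)))
    dominated-if-∈T s∈T (yes B-unit) = inj₂ ((s R.- R.1# , M.0#) ,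
      ∈-++⁺ʳ Sᴾ (cartesianProduct T nonunitsᴹ)
        (∈-cartesianProduct⁺ R.setoid M.setoid s-1∈Tᶜ (here M.refl)) ,
      adjacent-×⁺ˡ R M (Γᴿ.unit-difference⇒adjacent 1≉0ᴿ s-[s-1]-unit)
        (Uᴹ.unit-cong (M.sym (Uᴹ.y≈0⇒x-y≈x B M.refl)) B-unit))
      where
      s-[s-1]-unit : Uᴿ.Unit (s R.- (s R.- R.1#))
      s-[s-1]-unit = Uᴿ.unit-cong (R.sym (Uᴿ.x-[x-y]≈y s R.1#)) Uᴿ.1#-unit
      s-1∈Tᶜ : s R.- R.1# ∈ᴿ Tᶜ
      s-1∈Tᶜ = ∈-filter⁺ R.setoid (∁? (Gᴿ._∈? T)) (∉-resp-≈ R.setoid) (Rᴱ.complete _)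
        (λ s-1∈T → Γᴿ.independent⇒nonunit-difference 1≉0ᴿ T-independent s∈T s-1∈T s-[s-1]-unit)
  ... | no s∉T = dominated-if-∉T (T-dominating s) (B Mᴱ.≟ M.0#)
    where
    dominated-if-∉T : Γᴿ.Dominated T s → Dec (B M.≈ M.0#) → ΓP.Dominated T×nonunits∪Tᶜ×0 (s , B)
    dominated-if-∉T (inj₁ s∈T) _ = contradiction s∈T s∉T
    dominated-if-∉T (inj₂ _) (yes B≈0) = inj₁ (∈-++⁺ʳ Sᴾ (cartesianProduct T nonunitsᴹ)
      (∈-cartesianProduct⁺ R.setoid M.setoid
        (∈-filter⁺ R.setoid (∁? (Gᴿ._∈? T)) (∉-resp-≈ R.setoid) (Rᴱ.complete s) s∉T) (here B≈0)))
    dominated-if-∉T (inj₂ (t , t∈T , s~t)) (no B≉0)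
      with A , A-nonunit , B-A-unit ← nonzero⇒nonunit-neighbour B B≉0 = inj₂ ((t , A) ,
        ∈-++⁺ˡ Sᴾ (∈-cartesianProduct⁺ R.setoid M.setoid t∈T
          (∈-filter⁺ M.setoid (∁? Gᴹ.unit?) nonunit-resp (Mᴱ.complete A) A-nonunit)) ,
        adjacent-×⁺ˡ R M s~t B-A-unit)

  T×nonunits∪Tᶜ×0-maximal : (∀ B → ¬ B M.≈ M.0# → Uᴹ.HasNonunitNeighbour B) →
                             MaximalIndependent (Ring.rawRing R×M) T×nonunits∪Tᶜ×0
  T×nonunits∪Tᶜ×0-maximal nonzero⇒nonunit-neighbour = ΓP.independent∧dominating⇒maximal
    T×nonunits∪Tᶜ×0-independent (T×nonunits∪Tᶜ×0-dominating nonzero⇒nonunit-neighbour)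

  |M|≡|units|+|nonunits| : length Mᴱ.elements ≡ length unitsᴹ + length nonunitsᴹ
  |M|≡|units|+|nonunits| = ≡.sym (length-filter+length-filter-∁ Gᴹ.unit? Mᴱ.elements)

  |R|≡|T|+|Tᶜ| : length Rᴱ.elements ≡ length T + length Tᶜ
  |R|≡|T|+|Tᶜ| = ≡.trans (≡.sym (length-filter+length-filter-∁ (Gᴿ._∈? T) Rᴱ.elements))
                         (≡.cong (_+ length Tᶜ) |R∩T|≡|T|)
    where
    R∩T : List R.Carrier
    R∩T = filter (Gᴿ._∈? T) Rᴱ.elements
    |R∩T|≡|T| : length R∩T ≡ length T
    |R∩T|≡|T| = ℕₚ.≤-antisym
      (unique∧⊆⇒length≤ R.setoid (UniqueProperties.filter⁺ R.setoid _ Rᴱ.unique)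
        (λ x∈R∩T → proj₂ (∈-filter⁻ R.setoid (Gᴿ._∈? T) (∈-resp-≈ R.setoid)
                                    {xs = Rᴱ.elements} x∈R∩T)))
      (unique∧⊆⇒length≤ R.setoid (Γᴿ.noDup⇒unique (proj₁ T-independent))
        (λ {x} x∈T → ∈-filter⁺ R.setoid (Gᴿ._∈? T) (∈-resp-≈ R.setoid) (Rᴱ.complete x) x∈T))

  length-T×M : length (cartesianProduct T Mᴱ.elements) ≡ length T * (length unitsᴹ + length nonunitsᴹ)
  length-T×M = ≡.trans (length-cartesianProduct T Mᴱ.elements) (≡.cong (length T *_) |M|≡|units|+|nonunits|)

  length-T×nonunits∪Tᶜ×0 : length T×nonunits∪Tᶜ×0 ≡ length T * length nonunitsᴹ + length Tᶜ
  length-T×nonunits∪Tᶜ×0 = ≡.trans (length-++ (cartesianProduct T nonunitsᴹ))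
    (≡.cong₂ _+_ (length-cartesianProduct T nonunitsᴹ)
                 (≡.trans (length-cartesianProduct Tᶜ (M.0# ∷ [])) (ℕₚ.*-identityʳ (length Tᶜ))))

  module _ {N : M.Carrier} (N≉0 : ¬ N M.≈ M.0#) (N²≈0 : N M.* N M.≈ M.0#) where

    T′ : List M.Carrier
    T′ = Gᴹ.extend (M.0# ∷ N ∷ [])

    T′-independent : Independent M.rawRing T′
    T′-independent = Gᴹ.extend-independent
      (Γᴹ.independent-snoc (Γᴹ.independent-snoc Γᴹ.independent-[] (λ ()) (λ _ ())) N∉[0] N-nonadjacent-0)
      where
      N∉[0] : ¬ N ∈ᴹ M.0# ∷ []
      N∉[0] (here N≈0) = N≉0 N≈0
      N-nonadjacent-0 : ∀ w → w ∈ᴹ M.0# ∷ [] → ¬ Adjacent M.rawRing N w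
      N-nonadjacent-0 w (here w≈0) (_ , u) =
        Uᴹ.square-zero⇒nonunit N≉0 N²≈0 (Uᴹ.unit-cong (Uᴹ.y≈0⇒x-y≈x N w≈0) u)

    T′-dominating : Γᴹ.Dominating T′
    T′-dominating = Gᴹ.extend-dominating _

    R×T′-maximal : MaximalIndependent (Ring.rawRing R×M) (cartesianProduct Rᴱ.elements T′)
    R×T′-maximal = ΓP.independent∧dominating⇒maximal
      (cartesianProduct-independentʳ R M 1≉0ᴹ Rᴱ.unique T′-independent)
      (cartesianProduct-dominatingʳ R M Rᴱ.complete T′-dominating)

    closedNeighbourhood : M.Carrier → List M.Carrier
    closedNeighbourhood t = t ∷ map (t M.+_) unitsᴹ

    unit-difference⇒∈-closedNeighbourhood : ∀ {v t} → Uᴹ.Unit (v M.- t) → v ∈ᴹ closedNeighbourhood t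
    unit-difference⇒∈-closedNeighbourhood {v} {t} u = there (∈-resp-≈ M.setoid (Uᴹ.x+[y-x]≈y t v)
      (∈-map⁺ M.setoid M.setoid M.+-congˡ
        (∈-filter⁺ M.setoid Gᴹ.unit? Uᴹ.unit-cong (Mᴱ.complete _) u)))

    elements⊆closedNeighbourhoods : Subset._⊆_ M.setoid Mᴱ.elements (concatMap closedNeighbourhood T′)
    elements⊆closedNeighbourhoods {v} _ with T′-dominating v
    ... | inj₁ v∈T′                = ∈-concatMap⁺ M.setoid M.setoid (Any.map here v∈T′)
    ... | inj₂ (w , w∈T′ , _ , u) = ∈-concatMap⁺ M.setoid M.setoid (Any.map
      (λ w≈t → unit-difference⇒∈-closedNeighbourhood (Uᴹ.unit-cong (M.+-congˡ (M.-‿cong w≈t)) u))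
      w∈T′)

    -- The closed neighbourhoods of 0 and N overlap in 1.
    |M|<|T′|[1+|Mˣ|] : length Mᴱ.elements < length T′ * suc (length unitsᴹ)
    |M|<|T′|[1+|Mˣ|] = ≡.subst (length Mᴱ.elements <_) length-cover
      (unique∧⊆-overlap⇒length< M.setoid {ys = closedNeighbourhood M.0#} Mᴱ.unique
        elements⊆closedNeighbourhoods 1∈closedNeighbourhood-0 (∈-++⁺ˡ M.setoid 1∈closedNeighbourhood-N))
      where
      length-cover : length (concatMap closedNeighbourhood T′) ≡ length T′ * suc (length unitsᴹ)
      length-cover =
        length-concatMap-const {f = closedNeighbourhood} (λ t → ≡.cong suc (length-map (t M.+_) unitsᴹ)) T′
      1∈closedNeighbourhood-0 : M.1# ∈ᴹ closedNeighbourhood M.0#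
      1∈closedNeighbourhood-0 = unit-difference⇒∈-closedNeighbourhood
        (Uᴹ.unit-cong (M.sym (Uᴹ.y≈0⇒x-y≈x M.1# M.refl)) Uᴹ.1#-unit)
      1∈closedNeighbourhood-N : M.1# ∈ᴹ closedNeighbourhood N
      1∈closedNeighbourhood-N = unit-difference⇒∈-closedNeighbourhood (Uᴹ.square-zero⇒1-unit N²≈0)

    length-R×T′ : length (cartesianProduct Rᴱ.elements T′) ≡ (length T + length Tᶜ) * length T′
    length-R×T′ = ≡.trans (length-cartesianProduct Rᴱ.elements T′) (≡.cong (_* length T′) |R|≡|T|+|Tᶜ|)

    ¬wellCovered : (∀ B → ¬ B M.≈ M.0# → Uᴹ.HasNonunitNeighbour B) → ¬ WellCovered (Ring.rawRing R×M)
    ¬wellCovered nonzero⇒nonunit-neighbour well-covered =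
      counting-contradiction (length (Gᴿ.additions (R.0# ∷ []) Rᴱ.elements))
        (≡.trans (≡.sym length-T×M) (≡.trans (well-covered _ _ T×M-maximal
          (T×nonunits∪Tᶜ×0-maximal nonzero⇒nonunit-neighbour)) length-T×nonunits∪Tᶜ×0))
        (≡.trans (≡.sym length-T×M) (≡.trans (well-covered _ _ T×M-maximal R×T′-maximal) length-R×T′))
        (≡.subst (_< length T′ * suc (length unitsᴹ)) |M|≡|units|+|nonunits| |M|<|T′|[1+|Mˣ|])

module Matrices {c ℓ} (F : FiniteField c ℓ) where
  open FiniteField F using (commRing; inverse) renaming (1≉0 to 1≉0ᶠ)
  open CommutativeRing commRing
  open Units ring using (x+[y-x]≈y; x-[x-y]≈y)
  open import Algebra.Properties.Ring ring using (-‿distribˡ-*)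
  open import Algebra.Properties.AbelianGroup +-abelianGroup using (ε⁻¹≈ε)
  open import Algebra.Properties.CommutativeSemigroup +-commutativeSemigroup using (interchange)
  open import Relation.Binary.Reasoning.Setoid setoid

  ∑ : (m : ℕ) → (Fin m → Carrier) → Carrier
  ∑ = sumF F

  ∑-cong : ∀ m {f g} → (∀ k → f k ≈ g k) → ∑ m f ≈ ∑ m g
  ∑-cong zero    f≈g = refl
  ∑-cong (suc m) f≈g = +-cong (f≈g Fin.zero) (∑-cong m (λ k → f≈g (Fin.suc k)))

  ∑-zero : ∀ m {f} → (∀ k → f k ≈ 0#) → ∑ m f ≈ 0#
  ∑-zero zero    f≈0 = refl
  ∑-zero (suc m) f≈0 = trans (+-cong (f≈0 Fin.zero) (∑-zero m (λ k → f≈0 (Fin.suc k)))) (+-identityʳ 0#)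

  ∑-distrib-+ : ∀ m f g → ∑ m (λ k → f k + g k) ≈ ∑ m f + ∑ m g
  ∑-distrib-+ zero    f g = sym (+-identityʳ 0#)
  ∑-distrib-+ (suc m) f g = trans (+-congˡ (∑-distrib-+ m _ _)) (interchange _ _ _ _)

  *-distribˡ-∑ : ∀ m x f → x * ∑ m f ≈ ∑ m (λ k → x * f k)
  *-distribˡ-∑ zero    x f = zeroʳ x
  *-distribˡ-∑ (suc m) x f = trans (distribˡ x _ _) (+-congˡ (*-distribˡ-∑ m x _))

  *-distribʳ-∑ : ∀ m x f → ∑ m f * x ≈ ∑ m (λ k → f k * x)
  *-distribʳ-∑ zero    x f = zeroˡ x
  *-distribʳ-∑ (suc m) x f = trans (distribʳ x _ _) (+-congˡ (*-distribʳ-∑ m x _))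

  ∑-comm : ∀ m p (f : Fin m → Fin p → Carrier) →
           ∑ m (λ i → ∑ p (f i)) ≈ ∑ p (λ j → ∑ m (λ i → f i j))
  ∑-comm zero    p f = sym (∑-zero p (λ _ → refl))
  ∑-comm (suc m) p f = trans (+-congˡ (∑-comm m p (f ∘′ Fin.suc))) (sym (∑-distrib-+ p _ _))

  ∑-select : ∀ m (d x : Fin m → Carrier) a → d a ≈ 1# → (∀ k → k ≢ a → d k ≈ 0#) →
             ∑ m (λ k → d k * x k) ≈ x a
  ∑-select (suc m) d x Fin.zero    dₐ≈1 d≈0 = begin
    d Fin.zero * x Fin.zero + ∑ m (λ k → d (Fin.suc k) * x (Fin.suc k))
      ≈⟨ +-cong (trans (*-congʳ dₐ≈1) (*-identityˡ _))
                (∑-zero m (λ k → trans (*-congʳ (d≈0 (Fin.suc k) (λ ()))) (zeroˡ _))) ⟩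
    x Fin.zero + 0#  ≈⟨ +-identityʳ _ ⟩
    x Fin.zero       ∎
  ∑-select (suc m) d x (Fin.suc a) dₐ≈1 d≈0 = begin
    d Fin.zero * x Fin.zero + ∑ m (λ k → d (Fin.suc k) * x (Fin.suc k))
      ≈⟨ +-cong (trans (*-congʳ (d≈0 Fin.zero (λ ()))) (zeroˡ _))
                (∑-select m (d ∘′ Fin.suc) (x ∘′ Fin.suc) a dₐ≈1
                  (λ k k≢a → d≈0 (Fin.suc k) (k≢a ∘′ suc-injective))) ⟩
    0# + x (Fin.suc a) ≈⟨ +-identityˡ _ ⟩
    x (Fin.suc a)      ∎

  ∑-selectʳ : ∀ m (x d : Fin m → Carrier) a → d a ≈ 1# → (∀ k → k ≢ a → d k ≈ 0#) →
              ∑ m (λ k → x k * d k) ≈ x a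
  ∑-selectʳ m x d a dₐ≈1 d≈0 = trans (∑-cong m (λ k → *-comm (x k) (d k))) (∑-select m d x a dₐ≈1 d≈0)

  module _ (n : ℕ) where
    private
      module Mat = RawRing (matRawRing F n)

    1ᴹ-diagonal : ∀ i → Mat.1# i i ≈ 1#
    1ᴹ-diagonal i with i Fin.≟ i
    ... | yes _   = refl
    ... | no i≢i = contradiction ≡.refl i≢i

    1ᴹ-off-diagonal : ∀ {i j} → i ≢ j → Mat.1# i j ≈ 0#
    1ᴹ-off-diagonal {i} {j} i≢j with i Fin.≟ j
    ... | yes i≡j = contradiction i≡j i≢j
    ... | no  _   = refl

    private
      *-assocᴹ : ∀ A B C → Mat._≈_ (Mat._*_ (Mat._*_ A B) C) (Mat._*_ A (Mat._*_ B C))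
      *-assocᴹ A B C i j = begin
        ∑ n (λ l → ∑ n (λ k → A i k * B k l) * C l j)   ≈⟨ ∑-cong n (λ l → *-distribʳ-∑ n (C l j) _) ⟩
        ∑ n (λ l → ∑ n (λ k → A i k * B k l * C l j))   ≈⟨ ∑-comm n n _ ⟩
        ∑ n (λ k → ∑ n (λ l → A i k * B k l * C l j))   ≈⟨ ∑-cong n (λ k → ∑-cong n (λ l → *-assoc _ _ _)) ⟩
        ∑ n (λ k → ∑ n (λ l → A i k * (B k l * C l j))) ≈⟨ ∑-cong n (λ k → *-distribˡ-∑ n (A i k) _) ⟨
        ∑ n (λ k → A i k * ∑ n (λ l → B k l * C l j))   ∎

    matRing : Ring c ℓ
    matRing = record
      { Carrier = Mat.Carrier ; _≈_ = Mat._≈_ ; _+_ = Mat._+_ ; _*_ = Mat._*_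
      ; -_ = Mat.-_ ; 0# = Mat.0# ; 1# = Mat.1#
      ; isRing = record
        { +-isAbelianGroup = record
          { isGroup = record
            { isMonoid = record
              { isSemigroup = record
                { isMagma = record
                  { isEquivalence = Setoid.isEquivalence (≋-setoid (≋-setoid setoid n) n)
                  ; ∙-cong = λ A≈B C≈D i j → +-cong (A≈B i j) (C≈D i j) }
                ; assoc = λ A B C i j → +-assoc (A i j) (B i j) (C i j) }
              ; identity = (λ A i j → +-identityˡ (A i j)) , (λ A i j → +-identityʳ (A i j)) }
            ; inverse = (λ A i j → -‿inverseˡ (A i j)) , (λ A i j → -‿inverseʳ (A i j))
            ; ⁻¹-cong = λ A≈B i j → -‿cong (A≈B i j) }
          ; comm = λ A B i j → +-comm (A i j) (B i j) }
        ; *-cong = λ A≈B C≈D i j → ∑-cong n (λ k → *-cong (A≈B i k) (C≈D k j))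
        ; *-assoc = *-assocᴹ
        ; *-identity =
            (λ A i j → ∑-select n (Mat.1# i) (λ k → A k j) i (1ᴹ-diagonal i)
                         (λ k k≢i → 1ᴹ-off-diagonal (k≢i ∘′ ≡.sym)))
          , (λ A i j → ∑-selectʳ n (A i) (λ k → Mat.1# k j) j (1ᴹ-diagonal j) (λ k → 1ᴹ-off-diagonal))
        ; distrib =
            (λ A B C i j → trans (∑-cong n (λ k → distribˡ (A i k) _ _)) (∑-distrib-+ n _ _))
          , (λ A B C i j → trans (∑-cong n (λ k → distribʳ (A k j) _ _)) (∑-distrib-+ n _ _))
        }
      }

    private
      module M = Ring matRing
      module Uᴹ = Units matRing

    1ᴹ≉0ᴹ : Fin n → ¬ M.1# M.≈ M.0#
    1ᴹ≉0ᴹ i 1≈0 = 1≉0ᶠ (trans (sym (1ᴹ-diagonal i)) (1≈0 i i))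

    zero-column⇒nonunit : ∀ {A} j → (∀ i → A i j ≈ 0#) → ¬ Uᴹ.Unit A
    zero-column⇒nonunit {A} j Aᵢⱼ≈0 (V , _ , VA≈1) = 1≉0ᶠ (begin
      1#                         ≈⟨ 1ᴹ-diagonal j ⟨
      M.1# j j                   ≈⟨ VA≈1 j j ⟨
      ∑ n (λ k → V j k * A k j)  ≈⟨ ∑-zero n (λ k → trans (*-congˡ (Aᵢⱼ≈0 k)) (zeroʳ _)) ⟩
      0#                         ∎)

    replaceColumn : Fin n → (Fin n → Carrier) → M.Carrier
    replaceColumn j x a k with k Fin.≟ j
    ... | yes _ = x a
    ... | no  _ = M.1# a k

    replaceColumn-column : ∀ j x a → replaceColumn j x a j ≈ x a
    replaceColumn-column j x a with j Fin.≟ j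
    ... | yes _   = refl
    ... | no j≢j = contradiction ≡.refl j≢j

    replaceColumn-*ʳ : ∀ j x a (z : Fin n → Carrier) →
                       ∑ n (λ k → replaceColumn j x a k * z k) ≈ z a + (x a - M.1# a j) * z j
    replaceColumn-*ʳ j x a z = begin
      ∑ n (λ k → replaceColumn j x a k * z k)
        ≈⟨ ∑-cong n entry ⟩
      ∑ n (λ k → M.1# a k * z k + M.1# j k * ((x a - M.1# a j) * z k))
        ≈⟨ ∑-distrib-+ n _ _ ⟩
      ∑ n (λ k → M.1# a k * z k) + ∑ n (λ k → M.1# j k * ((x a - M.1# a j) * z k))
        ≈⟨ +-cong (∑-select n (M.1# a) z a (1ᴹ-diagonal a) (λ k k≢a → 1ᴹ-off-diagonal (k≢a ∘′ ≡.sym)))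
                  (∑-select n (M.1# j) _ j (1ᴹ-diagonal j) (λ k k≢j → 1ᴹ-off-diagonal (k≢j ∘′ ≡.sym))) ⟩
      z a + (x a - M.1# a j) * z j
        ∎
      where
      entry : ∀ k → replaceColumn j x a k * z k ≈ M.1# a k * z k + M.1# j k * ((x a - M.1# a j) * z k)
      entry k with k Fin.≟ j
      ... | yes ≡.refl = sym (begin
        M.1# a k * z k + M.1# k k * ((x a - M.1# a k) * z k)
          ≈⟨ +-congˡ (trans (*-congʳ (1ᴹ-diagonal k)) (*-identityˡ _)) ⟩
        M.1# a k * z k + (x a - M.1# a k) * z k  ≈⟨ distribʳ (z k) _ _ ⟨
        (M.1# a k + (x a - M.1# a k)) * z k      ≈⟨ *-congʳ (x+[y-x]≈y _ _) ⟩
        x a * z k                                ∎)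
      ... | no k≢j = sym (trans (+-congˡ (trans (*-congʳ (1ᴹ-off-diagonal (k≢j ∘′ ≡.sym))) (zeroˡ _)))
                                (+-identityʳ _))

    replaceColumn-inverse : ∀ j x y → x j * y j ≈ 1# → (∀ a → a ≢ j → y a + x a * y j ≈ 0#) →
                            (replaceColumn j x M.* replaceColumn j y) M.≈ M.1#
    replaceColumn-inverse j x y xⱼyⱼ≈1 yₐ+xₐyⱼ≈0 a b =
      trans (replaceColumn-*ʳ j x a (λ k → replaceColumn j y k b)) entry
      where
      entry : replaceColumn j y a b + (x a - M.1# a j) * replaceColumn j y j b ≈ M.1# a b
      entry with b Fin.≟ j
      ... | no b≢j = trans (+-congˡ (trans (*-congˡ (1ᴹ-off-diagonal (b≢j ∘′ ≡.sym))) (zeroʳ _)))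
                           (+-identityʳ _)
      ... | yes ≡.refl = column-j a (a Fin.≟ j)
        where
        column-j : ∀ a → Dec (a ≡ j) → y a + (x a - M.1# a j) * y j ≈ M.1# a j
        column-j a (no a≢j) = begin
          y a + (x a - M.1# a j) * y j
            ≈⟨ +-congˡ (*-congʳ (+-congˡ (trans (-‿cong (1ᴹ-off-diagonal a≢j)) ε⁻¹≈ε))) ⟩
          y a + (x a + 0#) * y j       ≈⟨ +-congˡ (*-congʳ (+-identityʳ _)) ⟩
          y a + x a * y j              ≈⟨ yₐ+xₐyⱼ≈0 a a≢j ⟩
          0#                           ≈⟨ 1ᴹ-off-diagonal a≢j ⟨
          M.1# a j                     ∎
        column-j a (yes ≡.refl) = begin
          y a + (x a - M.1# a a) * y a      ≈⟨ +-congʳ (*-identityˡ (y a)) ⟨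
          1# * y a + (x a - M.1# a a) * y a ≈⟨ distribʳ (y a) _ _ ⟨
          (1# + (x a - M.1# a a)) * y a     ≈⟨ *-congʳ (+-congˡ (+-congˡ (-‿cong (1ᴹ-diagonal a)))) ⟩
          (1# + (x a - 1#)) * y a           ≈⟨ *-congʳ (x+[y-x]≈y 1# (x a)) ⟩
          x a * y a                         ≈⟨ xⱼyⱼ≈1 ⟩
          1#                                ≈⟨ 1ᴹ-diagonal a ⟨
          M.1# a a                          ∎

    -- The inverse of replaceColumn j x replaces column j by the vector y with
    -- y j = (x j)⁻¹ and y a = - x a (x j)⁻¹ for a ≢ j.
    replaceColumn-unit : ∀ j x → ¬ x j ≈ 0# → Uᴹ.Unit (replaceColumn j x)
    replaceColumn-unit j x xⱼ≉0 with c , xⱼc≈1 ← inverse (x j) xⱼ≉0 =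
      replaceColumn j y , replaceColumn-inverse j x y xⱼyⱼ≈1 yₐ+xₐyⱼ≈0 ,
      replaceColumn-inverse j y x (trans (*-comm (y j) (x j)) xⱼyⱼ≈1) xₐ+yₐxⱼ≈0
      where
      y : Fin n → Carrier
      y a with a Fin.≟ j
      ... | yes _ = c
      ... | no  _ = - (x a * c)
      yⱼ≈c : y j ≈ c
      yⱼ≈c with j Fin.≟ j
      ... | yes _   = refl
      ... | no j≢j = contradiction ≡.refl j≢j
      yₐ≈-xₐc : ∀ a → a ≢ j → y a ≈ - (x a * c)
      yₐ≈-xₐc a a≢j with a Fin.≟ j
      ... | yes a≡j = contradiction a≡j a≢j
      ... | no  _   = refl
      xⱼyⱼ≈1 : x j * y j ≈ 1#
      xⱼyⱼ≈1 = trans (*-congˡ yⱼ≈c) xⱼc≈1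
      yₐ+xₐyⱼ≈0 : ∀ a → a ≢ j → y a + x a * y j ≈ 0#
      yₐ+xₐyⱼ≈0 a a≢j = trans (+-cong (yₐ≈-xₐc a a≢j) (*-congˡ yⱼ≈c)) (-‿inverseˡ _)
      xₐ+yₐxⱼ≈0 : ∀ a → a ≢ j → x a + y a * x j ≈ 0#
      xₐ+yₐxⱼ≈0 a a≢j = begin
        x a + y a * x j           ≈⟨ +-congˡ (*-congʳ (yₐ≈-xₐc a a≢j)) ⟩
        x a + - (x a * c) * x j   ≈⟨ +-congˡ (-‿distribˡ-* _ _) ⟨
        x a - x a * c * x j       ≈⟨ +-congˡ (-‿cong (*-assoc _ _ _)) ⟩
        x a - x a * (c * x j)     ≈⟨ +-congˡ (-‿cong (*-congˡ (trans (*-comm c (x j)) xⱼc≈1))) ⟩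
        x a - x a * 1#            ≈⟨ +-congˡ (-‿cong (*-identityʳ _)) ⟩
        x a - x a                 ≈⟨ -‿inverseʳ _ ⟩
        0#                        ∎

    nonzero-diagonal⇒nonunit-neighbour : ∀ B j → ¬ B j j ≈ 0# → Uᴹ.HasNonunitNeighbour B
    nonzero-diagonal⇒nonunit-neighbour B j Bⱼⱼ≉0 =
      B M.- C , zero-column⇒nonunit j [B-C]ⱼ≈0 , Uᴹ.unit-cong (M.sym (Uᴹ.x-[x-y]≈y B C)) C-unit
      where
      C : M.Carrier
      C = replaceColumn j (λ a → B a j)
      C-unit : Uᴹ.Unit C
      C-unit = replaceColumn-unit j (λ a → B a j) Bⱼⱼ≉0
      [B-C]ⱼ≈0 : ∀ a → (B M.- C) a j ≈ 0#
      [B-C]ⱼ≈0 a = trans (+-congˡ (-‿cong (replaceColumn-column j _ a))) (-‿inverseʳ _)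

    matrixUnit : Fin n → Fin n → M.Carrier
    matrixUnit a b i j = M.1# i a * M.1# b j

    matrixUnit-nonzero : ∀ a b → ¬ matrixUnit a b M.≈ M.0#
    matrixUnit-nonzero a b Eₐᵦ≈0 =
      1≉0ᶠ (trans (sym (trans (*-cong (1ᴹ-diagonal a) (1ᴹ-diagonal b)) (*-identityˡ 1#))) (Eₐᵦ≈0 a b))

    matrixUnit-square-zero : ∀ {a b} → a ≢ b → (matrixUnit a b M.* matrixUnit a b) M.≈ M.0#
    matrixUnit-square-zero {a} {b} a≢b i j = ∑-zero n (λ k → term k (k Fin.≟ a))
      where
      term : ∀ k → Dec (k ≡ a) → M.1# i a * M.1# b k * (M.1# k a * M.1# b j) ≈ 0#
      term k (yes ≡.refl) =
        trans (*-congʳ (trans (*-congˡ (1ᴹ-off-diagonal (a≢b ∘′ ≡.sym))) (zeroʳ _))) (zeroˡ _)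
      term k (no k≢a)     = trans (*-congˡ (trans (*-congʳ (1ᴹ-off-diagonal k≢a)) (zeroˡ _))) (zeroʳ _)

    *-[1+matrixUnit]-diagonal : ∀ B i j → (B M.* (M.1# M.+ matrixUnit j i)) i i ≈ B i i + B i j
    *-[1+matrixUnit]-diagonal B i j = begin
      ∑ n (λ k → B i k * (M.1# k i + M.1# k j * M.1# i i))
        ≈⟨ ∑-cong n (λ k → distribˡ (B i k) _ _) ⟩
      ∑ n (λ k → B i k * M.1# k i + B i k * (M.1# k j * M.1# i i))
        ≈⟨ ∑-distrib-+ n _ _ ⟩
      ∑ n (λ k → B i k * M.1# k i) + ∑ n (λ k → B i k * (M.1# k j * M.1# i i))
        ≈⟨ +-cong (∑-selectʳ n (B i) (λ k → M.1# k i) i (1ᴹ-diagonal i) (λ k → 1ᴹ-off-diagonal))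
                  (∑-selectʳ n (B i) (λ k → M.1# k j * M.1# i i) j
                    (trans (*-cong (1ᴹ-diagonal j) (1ᴹ-diagonal i)) (*-identityˡ 1#))
                    (λ k k≢j → trans (*-congʳ (1ᴹ-off-diagonal k≢j)) (zeroˡ _))) ⟩
      B i i + B i j
        ∎

    -- If Bᵢᵢ ≈ 0 ≉ Bᵢⱼ, right multiplication by the unit 1 + Eⱼᵢ adds column j to column i.
    nonzero⇒nonunit-neighbour : Binary.Decidable _≈_ → ∀ {B} → ¬ B M.≈ M.0# → Uᴹ.HasNonunitNeighbour B
    nonzero⇒nonunit-neighbour _≟_ {B} B≉0
      with i , Bᵢ≉0 ← ¬∀⟶∃¬ n _ (λ i → all? (λ j → B i j ≟ 0#)) B≉0
      with j , Bᵢⱼ≉0 ← ¬∀⟶∃¬ n _ (λ j → B i j ≟ 0#) Bᵢ≉0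
      with B i i ≟ 0#
    ... | no  Bᵢᵢ≉0 = nonzero-diagonal⇒nonunit-neighbour B i Bᵢᵢ≉0
    ... | yes Bᵢᵢ≈0 = Uᴹ.nonunit-neighbour-*ʳ (Uᴹ.square-zero⇒1+unit (matrixUnit-square-zero j≢i))
                        (nonzero-diagonal⇒nonunit-neighbour _ i [B[1+E]]ᵢᵢ≉0)
      where
      j≢i : j ≢ i
      j≢i ≡.refl = Bᵢⱼ≉0 Bᵢᵢ≈0
      [B[1+E]]ᵢᵢ≉0 : ¬ (B M.* (M.1# M.+ matrixUnit j i)) i i ≈ 0#
      [B[1+E]]ᵢᵢ≉0 [B[1+E]]ᵢᵢ≈0 = Bᵢⱼ≉0 (begin
        B i j                                     ≈⟨ +-identityˡ _ ⟨
        0# + B i j                                ≈⟨ +-congʳ Bᵢᵢ≈0 ⟨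
        B i i + B i j                             ≈⟨ *-[1+matrixUnit]-diagonal B i j ⟨
        (B M.* (M.1# M.+ matrixUnit j i)) i i     ≈⟨ [B[1+E]]ᵢᵢ≈0 ⟩
        0#                                        ∎)

proposition3p4 : ∀ {c₁ ℓ₁ c₂ ℓ₂ : Level}
    (F : FiniteField c₂ ℓ₂) (n : ℕ) → n > 1 →
    (R : FiniteRing c₁ ℓ₁) →
    ¬ WellCovered (prodMat R F n)
proposition3p4 F n@(suc (suc _)) (s≤s (s≤s z≤n)) R =
  ¬wellCovered (FiniteRing.ring R) (matRing n) Rᴱ Mᴱ (FiniteRing.1≉0 R) (1ᴹ≉0ᴹ n Fin.zero)
    (matrixUnit-nonzero n Fin.zero (Fin.suc Fin.zero)) (matrixUnit-square-zero n {b = Fin.suc Fin.zero} (λ ()))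
    (λ B → nonzero⇒nonunit-neighbour n (Enumeration._≟_ Fᴱ))
  where
  open Matrices F
  Fᴱ : Enumeration (CommutativeRing.setoid (FiniteField.commRing F))
  Fᴱ = isFiniteCarrier⇒enumeration (CommutativeRing.setoid (FiniteField.commRing F)) (FiniteField.finite F)
  Rᴱ : Enumeration (Ring.setoid (FiniteRing.ring R))
  Rᴱ = isFiniteCarrier⇒enumeration (Ring.setoid (FiniteRing.ring R)) (FiniteRing.finite R)
  Mᴱ : Enumeration (Ring.setoid (matRing n))
  Mᴱ = vectorEnumeration (vectorEnumeration Fᴱ n) n
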